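{- Let $\Delta$ be a simplicial complex on the vertex set $[n]=\{1,\dots,n\}$, and fix real coefficients $(a_T)_{T\in\Delta}$. Let $\mathfrak{I}$ be a cone of cooperative games on $\Delta$ (i.e. a cone in $\mathbb{R}^{\Delta}$) containing all the carrier games $v_T$ and $\hat v_T$, $\emptyset\neq T\in\Delta$. Let $\phi=(\phi_1,\dots,\phi_n)$ be a group value on $\mathfrak{I}$ and assume that there are real numbers $p^i_T$ ($i\in[n]$, $T\in\operatorname{Lk}_\Delta(i)$) such that for each $i\in[n]$ and each $v\in\mathfrak{I}$, \[ \phi_i(v)=\sum_{T\in \operatorname{Lk}_\Delta(i)}p_T^i\left(v(T\cup i)-v(T)\right). \] Then $\phi$ satisfies the general efficiency axiom, i.e. $\sum_{i=1}^n\phi_i(v)=\sum_{T\in\Delta}a_T v(T)$ for every $v\in\mathfrak{I}$, if and only if for every $T\in\Delta$ that is not a facet of $\Delta$ \[ \sum_{i\in T}p^i_{T\setminus i}-\sum_{j:\,T\in \operatorname{Lk}_\Delta(j)}p_T^j=a_T, \] and for every facet $F$ of $\Delta$ \[ \sum_{i\in F}p^i_{F\setminus i}=a_F. \]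
   Context: A simplicial complex $\Delta$ on $[n]$ is a family of subsets of $[n]$ such that $T\in\Delta$ and $S\subseteq T$ imply $S\in\Delta$. A facet is an element of $\Delta$ maximal under inclusion. For a vertex $i$, the link is $\operatorname{Lk}_\Delta(i)=\{T\in\Delta:\ i\notin T,\ T\cup\{i\}\in\Delta\}$. A cooperative game on $\Delta$ is a function $v:\Delta\to\mathbb{R}$ with $v(\emptyset)=0$; these form the real vector space $\mathbb{R}^{\Delta}$. A group value on $\mathfrak{I}$ is a tuple of functions $\phi_i:\mathfrak{I}\to\mathbb{R}$, $i\in[n]$. For $T\in\Delta$ the carrier games are $v_T(S)=1$ if $T\subseteq S$ and $0$ otherwise, and $\hat v_T(S)=1$ if $T\subsetneq S$ and $0$ otherwise ($S\in\Delta$). Notation $T\cup i$, $T\setminus i$ means $T\cup\{i\}$, $T\setminus\{i\}$. -}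

module Defs where

open import Level using (Level; _⊔_; 0ℓ) renaming (suc to lsuc)
open import Data.Nat using (ℕ; zero; suc)
open import Data.Bool using (Bool; true; false; if_then_else_)
open import Data.Fin using (Fin)
open import Data.Fin.Subset using (Subset; _∈_; _∉_; _⊆_; _⊂_; _∪_; _-_; ⁅_⁆; ⊥; Nonempty)
open import Data.Fin.Subset.Properties using (_∈?_; _⊆?_; _⊂?_)
open import Data.List using (List; []; _∷_; _++_; map; foldr; allFin)
open import Data.Vec using (Vec; []; _∷_)
open import Data.Product using (_×_; ∃; _,_)
open import Relation.Nullary using (¬_; Dec; yes; no; does)
open import Relation.Nullary.Decidable using (_×-dec_; ¬?)
open import Relation.Unary using (Pred; Decidable)
open import Relation.Binary using (IsTotalOrder)
open import Relation.Binary.PropositionalEquality using (_≡_)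
open import Algebra.Bundles using (CommutativeRing)

-- Ordered fields (ℝ is an instance).  The theorem is stated over an
-- arbitrary ordered field, which in particular covers ℝ.

record OrderedField (c ℓ ℓ≤ : Level) : Set (lsuc (c ⊔ ℓ ⊔ ℓ≤)) where
  field
    commutativeRing : CommutativeRing c ℓ
  open CommutativeRing commutativeRing public
  infix 4 _≤_
  field
    _≤_          : Carrier → Carrier → Set ℓ≤
    isTotalOrder : IsTotalOrder _≈_ _≤_
    +-mono-≤     : ∀ {x y} z → x ≤ y → x + z ≤ y + z
    *-nonneg     : ∀ {x y} → 0# ≤ x → 0# ≤ y → 0# ≤ x * y
    0≉1          : ¬ (0# ≈ 1#)
    inverse      : ∀ x → ¬ (x ≈ 0#) → ∃ λ y → x * y ≈ 1#

record SimplicialComplex (n : ℕ) : Set₁ where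
  field
    face        : Pred (Subset n) 0ℓ
    face?       : Decidable face
    down-closed : ∀ {S T} → face T → S ⊆ T → face S

module _ {n : ℕ} (Δ : SimplicialComplex n) where
  open SimplicialComplex Δ

  IsFacet : Subset n → Set
  IsFacet F = face F × (∀ S → face S → F ⊆ S → S ≡ F)

  InLink : Fin n → Subset n → Set
  InLink i T = face T × (i ∉ T × face (T ∪ ⁅ i ⁆))

  InLink? : ∀ i T → Dec (InLink i T)
  InLink? i T = face? T ×-dec (¬? (i ∈? T) ×-dec face? (T ∪ ⁅ i ⁆))

allSubsets : (n : ℕ) → List (Subset n)
allSubsets zero    = [] ∷ []
allSubsets (suc n) = map (true ∷_) (allSubsets n) ++ map (false ∷_) (allSubsets n)

module Sums {c ℓ ℓ≤} (K : OrderedField c ℓ ℓ≤) where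
  open OrderedField K

  sumWhere : ∀ {a p} {A : Set a} {P : Pred A p} → Decidable P → List A → (A → Carrier) → Carrier
  sumWhere P? xs f = foldr (λ x acc → if does (P? x) then f x + acc else acc) 0# xs

  sumFin : ∀ {n} → (Fin n → Carrier) → Carrier
  sumFin {n} f = foldr (λ i acc → f i + acc) 0# (allFin n)

  sumIn : ∀ {n} → Subset n → (Fin n → Carrier) → Carrier
  sumIn {n} T f = sumWhere (_∈? T) (allFin n) f

  sumΔ : ∀ {n} → SimplicialComplex n → (Subset n → Carrier) → Carrier
  sumΔ {n} Δ f = sumWhere (SimplicialComplex.face? Δ) (allSubsets n) f

  sumLk : ∀ {n} → SimplicialComplex n → Fin n → (Subset n → Carrier) → Carrier
  sumLk {n} Δ i f = sumWhere (InLink? Δ i) (allSubsets n) f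

  sumLinkers : ∀ {n} → SimplicialComplex n → Subset n → (Fin n → Carrier) → Carrier
  sumLinkers {n} Δ T f = sumWhere (λ j → InLink? Δ j T) (allFin n) f

-- Cooperative games on Δ, represented as functions on all subsets of
-- [n] that vanish at ∅ and outside Δ (this identifies them with ℝ^Δ
-- with v(∅) = 0).

module Games {c ℓ ℓ≤} (K : OrderedField c ℓ ℓ≤) {n : ℕ} (Δ : SimplicialComplex n) where
  open OrderedField K
  open SimplicialComplex Δ

  Game : Set c
  Game = Subset n → Carrier

  IsGame : Game → Set ℓ
  IsGame v = (v ⊥ ≈ 0#) × (∀ S → ¬ face S → v S ≈ 0#)

  carrier : Subset n → Game
  carrier T S with face? S | T ⊆? S
  ... | yes _ | yes _ = 1#
  ... | _     | _     = 0#

  carrierHat : Subset n → Game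
  carrierHat T S with face? S | T ⊂? S
  ... | yes _ | yes _ = 1#
  ... | _     | _     = 0#

  IsCone : ∀ {ι} → Pred Game ι → Set (c ⊔ ℓ ⊔ ℓ≤ ⊔ ι)
  IsCone 𝔍 = (∀ v → 𝔍 v → IsGame v)
           × (∀ v α → 𝔍 v → 0# ≤ α → 𝔍 (λ S → α * v S))

module Submission where

-- Write  gain S = Σ_{i ∈ S} p^i_{S∖i},  loss S = Σ_{j : S ∈ Lk(j)} p^j_S  and
-- coeff S = gain S − loss S.  The proof has three ingredients.
--
--  1. Reindexing.  For every game v,
--       Σ_i Σ_{T ∈ Lk(i)} p^i_T (v(T ∪ i) − v(T)) = Σ_{S ∈ Δ} coeff S · v(S),
--     because the pairs (i, T) with T ∈ Lk(i) correspond bijectively, via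
--     S = T ∪ i, to the pairs (i, S) with S ∈ Δ and i ∈ S.  Sums are handled
--     as sums over explicit lists weighted by indicator factors, which makes
--     swapping and reindexing sums purely algebraic.
--  2. Facets.  A face is a facet iff it lies in no link, so loss F = 0 on a
--     facet F; hence "coeff = a on nonempty faces" is exactly the system of
--     equations in the theorem.
--  3. Probing with carrier games.  For T ∈ Δ, v_T − v̂_T is the indicator of
--     T on Δ, so two coefficient vectors give the same linear functional on
--     a set of games containing all carrier games iff they agree on
--     nonempty faces.
-- By 1, efficiency says that coeff and a give the same functional on 𝔍; by
-- 3 this means coeff = a on nonempty faces, and by 2 this is the system.

open import Defs
open import Data.Nat using (ℕ; suc)
open import Data.Bool using (true; false)
import Data.Bool as Bool
open import Data.Fin using (Fin; zero; suc)
open import Data.Fin.Subset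
  using (Subset; Nonempty; _∪_; _─_; ⁅_⁆; _∈_; _∉_; _⊆_; _⊂_; ⊥)
open import Data.Fin.Subset.Properties
  using ( _∈?_; _⊆?_; _⊂?_; p─⊥≡p; ∪-identityʳ; p─q⊆p; p⊆p∪q; q⊆p∪q; x∈⁅x⁆
        ; x∈⁅y⁆⇒x≡y; x∈p∪q⁻; ⊆-antisym; ⊂-irref; nonempty?; Empty-unique)
open import Data.Fin.Properties using (any?)
open import Data.List using (List; []; _∷_; _++_; map; foldr; allFin)
open import Data.Vec using ([]; _∷_; here; there)
open import Data.Vec.Properties using (≡-dec; ∷-injective)
open import Data.Product using (_×_; _,_; proj₁; proj₂; ∃)
open import Data.Sum using (_⊎_; inj₁; inj₂)
open import Data.Empty using (⊥-elim)
open import Relation.Nullary using (¬_; Dec; yes; no)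
open import Relation.Nullary.Decidable using (_×-dec_)
open import Relation.Unary using (Pred; Decidable)
open import Relation.Binary.Definitions using (DecidableEquality)
open import Relation.Binary.PropositionalEquality as ≡ using (_≡_; _≢_)
open import Algebra.Bundles using (CommutativeRing)
open import Function.Bundles using (_⇔_; mk⇔)
open import Function.Construct.Composition using (_⇔-∘_)

-- Subsets of [n]

_≟ˢ_ : ∀ {n} → DecidableEquality (Subset n)
_≟ˢ_ = ≡-dec Bool._≟_

∪-─-cancel : ∀ {n} (T : Subset n) i → i ∉ T → (T ∪ ⁅ i ⁆) ─ ⁅ i ⁆ ≡ T
∪-─-cancel (true  ∷ T) zero    i∉T = ⊥-elim (i∉T here)
∪-─-cancel (false ∷ T) zero    i∉T =
  ≡.cong (false ∷_) (≡.trans (p─⊥≡p (T ∪ ⊥)) (∪-identityʳ T))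
∪-─-cancel (true  ∷ T) (suc i) i∉T =
  ≡.cong (true ∷_) (∪-─-cancel T i (λ i∈T → i∉T (there i∈T)))
∪-─-cancel (false ∷ T) (suc i) i∉T =
  ≡.cong (false ∷_) (∪-─-cancel T i (λ i∈T → i∉T (there i∈T)))

─-∪-cancel : ∀ {n} (S : Subset n) i → i ∈ S → (S ─ ⁅ i ⁆) ∪ ⁅ i ⁆ ≡ S
─-∪-cancel (true  ∷ S) zero    here =
  ≡.cong (true ∷_) (≡.trans (≡.cong (_∪ ⊥) (p─⊥≡p S)) (∪-identityʳ S))
─-∪-cancel (true  ∷ S) (suc i) (there i∈S) = ≡.cong (true ∷_)  (─-∪-cancel S i i∈S)
─-∪-cancel (false ∷ S) (suc i) (there i∈S) = ≡.cong (false ∷_) (─-∪-cancel S i i∈S)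

i∉S─i : ∀ {n} (S : Subset n) i → i ∉ S ─ ⁅ i ⁆
i∉S─i (b ∷ S) zero    ()
i∉S─i (b ∷ S) (suc i) (there i∈) = i∉S─i S i i∈

i∈S∪i : ∀ {n} (S : Subset n) i → i ∈ S ∪ ⁅ i ⁆
i∈S∪i S i = q⊆p∪q S ⁅ i ⁆ (x∈⁅x⁆ i)

⊆∧⊄⇒≡ : ∀ {n} {T S : Subset n} → T ⊆ S → ¬ (T ⊂ S) → T ≡ S
⊆∧⊄⇒≡ {T = T} {S} T⊆S T⊄S = ⊆-antisym T⊆S S⊆T
  where
  S⊆T : S ⊆ T
  S⊆T {x} x∈S with x ∈? T
  ... | yes x∈T = x∈T
  ... | no  x∉T = ⊥-elim (T⊄S (T⊆S , x , x∈S , x∉T))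

-- Facets and links

module Facets {n : ℕ} (Δ : SimplicialComplex n) where
  open SimplicialComplex Δ

  -- A facet lies in no link: F ∪ j would be a larger face.
  facet-unlinked : ∀ F j → IsFacet Δ F → ¬ InLink Δ j F
  facet-unlinked F j (_ , maximal) (_ , j∉F , face-F∪j) =
    j∉F (≡.subst (j ∈_) (maximal (F ∪ ⁅ j ⁆) face-F∪j (p⊆p∪q ⁅ j ⁆)) (i∈S∪i F j))

  -- Conversely, a face lying in no link is maximal, since every vertex of
  -- a larger face would put the face in its link.
  unlinked⇒facet : ∀ S → face S → ¬ (∃ λ j → InLink Δ j S) → IsFacet Δ S
  unlinked⇒facet S face-S unlinked = face-S , maximal
    where
    maximal : ∀ S′ → face S′ → S ⊆ S′ → S′ ≡ S
    maximal S′ face-S′ S⊆S′ = ≡.sym (⊆-antisym S⊆S′ S′⊆S)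
      where
      S′⊆S : S′ ⊆ S
      S′⊆S {x} x∈S′ with x ∈? S
      ... | yes x∈S = x∈S
      ... | no  x∉S = ⊥-elim (unlinked (x , face-S , x∉S , down-closed face-S′ S∪x⊆S′))
        where
        S∪x⊆S′ : S ∪ ⁅ x ⁆ ⊆ S′
        S∪x⊆S′ {y} y∈ with x∈p∪q⁻ S ⁅ x ⁆ y∈
        ... | inj₁ y∈S = S⊆S′ y∈S
        ... | inj₂ y∈x = ≡.subst (_∈ S′) (≡.sym (x∈⁅y⁆⇒x≡y x y∈x)) x∈S′

  facet-or-linked : ∀ S → face S → IsFacet Δ S ⊎ ∃ λ j → InLink Δ j S
  facet-or-linked S face-S with any? (λ j → InLink? Δ j S)
  ... | yes linked   = inj₂ linked
  ... | no  unlinked = inj₁ (unlinked⇒facet S face-S unlinked)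

-- Sums over lists in a commutative ring, with indicator factors

module ListSums {c ℓ} (R : CommutativeRing c ℓ) where
  open CommutativeRing R
  open import Algebra.Properties.AbelianGroup +-abelianGroup using (ε⁻¹≈ε; ⁻¹-∙-comm)
  open import Algebra.Properties.CommutativeSemigroup +-commutativeSemigroup
    using (interchange)

  x-0≈x : ∀ x → x - 0# ≈ x
  x-0≈x x = trans (+-congˡ ε⁻¹≈ε) (+-identityʳ x)

  −-interchange : ∀ a b c d → (a - b) + (c - d) ≈ (a + c) - (b + d)
  −-interchange a b c d = trans (interchange a (- b) c (- d)) (+-congˡ (⁻¹-∙-comm b d))

  Σ : ∀ {a} {A : Set a} → List A → (A → Carrier) → Carrier
  Σ xs f = foldr (λ x acc → f x + acc) 0# xs

  when : ∀ {p} {P : Set p} → Dec P → Carrier → Carrier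
  when (yes _) x = x
  when (no _)  _ = 0#

  module _ {a} {A : Set a} where

    Σ-cong : ∀ (xs : List A) {f g} → (∀ x → f x ≈ g x) → Σ xs f ≈ Σ xs g
    Σ-cong []       f≈g = refl
    Σ-cong (x ∷ xs) f≈g = +-cong (f≈g x) (Σ-cong xs f≈g)

    Σ-zero : ∀ (xs : List A) {f} → (∀ x → f x ≈ 0#) → Σ xs f ≈ 0#
    Σ-zero []       f≈0 = refl
    Σ-zero (x ∷ xs) f≈0 = trans (+-cong (f≈0 x) (Σ-zero xs f≈0)) (+-identityˡ 0#)

    Σ-+ : ∀ (xs : List A) f g → Σ xs (λ x → f x + g x) ≈ Σ xs f + Σ xs g
    Σ-+ []       f g = sym (+-identityˡ 0#)
    Σ-+ (x ∷ xs) f g = trans (+-congˡ (Σ-+ xs f g)) (interchange _ _ _ _)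

    Σ-− : ∀ (xs : List A) f g → Σ xs (λ x → f x - g x) ≈ Σ xs f - Σ xs g
    Σ-− []       f g = sym (x-0≈x 0#)
    Σ-− (x ∷ xs) f g = trans (+-congˡ (Σ-− xs f g)) (−-interchange _ _ _ _)

    Σ-*ʳ : ∀ (xs : List A) f k → Σ xs (λ x → f x * k) ≈ Σ xs f * k
    Σ-*ʳ []       f k = sym (zeroˡ k)
    Σ-*ʳ (x ∷ xs) f k = trans (+-congˡ (Σ-*ʳ xs f k)) (sym (distribʳ k _ _))

    Σ-++ : ∀ (xs ys : List A) f → Σ (xs ++ ys) f ≈ Σ xs f + Σ ys f
    Σ-++ []       ys f = sym (+-identityˡ _)
    Σ-++ (x ∷ xs) ys f = trans (+-congˡ (Σ-++ xs ys f)) (sym (+-assoc _ _ _))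

    Σ-map : ∀ {b} {B : Set b} (g : B → A) (ys : List B) f →
            Σ (map g ys) f ≡ Σ ys (λ y → f (g y))
    Σ-map g []       f = ≡.refl
    Σ-map g (y ∷ ys) f = ≡.cong (f (g y) +_) (Σ-map g ys f)

  Σ-swap : ∀ {a b} {A : Set a} {B : Set b} (xs : List A) (ys : List B) (f : A → B → Carrier) →
           Σ xs (λ x → Σ ys (f x)) ≈ Σ ys (λ y → Σ xs (λ x → f x y))
  Σ-swap []       ys f = sym (Σ-zero ys (λ _ → refl))
  Σ-swap (x ∷ xs) ys f =
    trans (+-congˡ (Σ-swap xs ys f)) (sym (Σ-+ ys (f x) (λ y → Σ xs (λ x′ → f x′ y))))

  module _ {p} {P : Set p} where

    when-cong : ∀ (d : Dec P) {x y} → x ≈ y → when d x ≈ when d y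
    when-cong (yes _) x≈y = x≈y
    when-cong (no _)  x≈y = refl

    when-yes : ∀ (d : Dec P) x → P → when d x ≈ x
    when-yes (yes _) x _  = refl
    when-yes (no ¬p) x p = ⊥-elim (¬p p)

    when-no : ∀ (d : Dec P) x → ¬ P → when d x ≈ 0#
    when-no (yes p) x ¬p = ⊥-elim (¬p p)
    when-no (no _)  x ¬p = refl

    when-*ʳ : ∀ (d : Dec P) x y → when d x * y ≈ when d (x * y)
    when-*ʳ (yes _) x y = refl
    when-*ʳ (no _)  x y = zeroˡ y

    when-− : ∀ (d : Dec P) x y → when d (x - y) ≈ when d x - when d y
    when-− (yes _) x y = refl
    when-− (no _)  x y = sym (x-0≈x 0#)

    when-Σ : ∀ {a} {A : Set a} (d : Dec P) (xs : List A) f →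
             when d (Σ xs f) ≈ Σ xs (λ x → when d (f x))
    when-Σ (yes _) xs f = refl
    when-Σ (no _)  xs f = sym (Σ-zero xs (λ _ → refl))

    when-× : ∀ {q} {Q : Set q} (d : Dec P) (e : Dec Q) x → when d (when e x) ≈ when (d ×-dec e) x
    when-× (yes _) (yes _) x = refl
    when-× (yes _) (no _)  x = refl
    when-× (no _)  e       x = refl

    when-⇔ : ∀ {q} {Q : Set q} (d : Dec P) (e : Dec Q) x → (P → Q) → (Q → P) → when d x ≈ when e x
    when-⇔ (yes _) (yes _) x P→Q Q→P = refl
    when-⇔ (yes p) (no ¬q) x P→Q Q→P = ⊥-elim (¬q (P→Q p))
    when-⇔ (no ¬p) (yes q) x P→Q Q→P = ⊥-elim (¬p (Q→P q))
    when-⇔ (no _)  (no _)  x P→Q Q→P = refl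

-- The sums of Defs, and sums over all subsets of [n]

module SubsetSums {c ℓ ℓ≤} (K : OrderedField c ℓ ℓ≤) where
  open OrderedField K
  open Sums K
  open ListSums commutativeRing

  module _ {a p} {A : Set a} {P : Pred A p} (P? : Decidable P) where

    sumWhere≈Σ : ∀ (xs : List A) f → sumWhere P? xs f ≈ Σ xs (λ x → when (P? x) (f x))
    sumWhere≈Σ []       f = refl
    sumWhere≈Σ (x ∷ xs) f with P? x
    ... | yes _ = +-congˡ (sumWhere≈Σ xs f)
    ... | no  _ = trans (sumWhere≈Σ xs f) (sym (+-identityˡ _))

    sumWhere-cong : ∀ (xs : List A) {f g} → (∀ x → P x → f x ≈ g x) →
                    sumWhere P? xs f ≈ sumWhere P? xs g
    sumWhere-cong []       f≈g = refl
    sumWhere-cong (x ∷ xs) f≈g with P? x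
    ... | yes Px = +-cong (f≈g x Px) (sumWhere-cong xs f≈g)
    ... | no  _  = sumWhere-cong xs f≈g

    sumWhere-none : ∀ (xs : List A) f → (∀ x → ¬ P x) → sumWhere P? xs f ≈ 0#
    sumWhere-none xs f ¬P =
      trans (sumWhere≈Σ xs f) (Σ-zero xs (λ x → when-no (P? x) (f x) (¬P x)))

  Σ-allSubsets-suc : ∀ {n} (f : Subset (suc n) → Carrier) →
    Σ (allSubsets (suc n)) f ≈ Σ (allSubsets n) (λ S → f (true ∷ S)) + Σ (allSubsets n) (λ S → f (false ∷ S))
  Σ-allSubsets-suc {n} f = begin
    Σ (map (true ∷_) AS ++ map (false ∷_) AS) f
      ≈⟨ Σ-++ (map (true ∷_) AS) (map (false ∷_) AS) f ⟩
    Σ (map (true ∷_) AS) f + Σ (map (false ∷_) AS) f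
      ≡⟨ ≡.cong₂ _+_ (Σ-map (true ∷_) AS f) (Σ-map (false ∷_) AS f) ⟩
    Σ AS (λ S → f (true ∷ S)) + Σ AS (λ S → f (false ∷ S)) ∎
    where
    open import Relation.Binary.Reasoning.Setoid setoid
    AS = allSubsets n

  -- The sum over all subsets of a point indicator picks out the value at
  -- that point, since every subset occurs exactly once in allSubsets.
  Σ-point : ∀ {n} (X : Subset n) (g : Subset n → Carrier) →
            Σ (allSubsets n) (λ S → when (S ≟ˢ X) (g S)) ≈ g X

  matching : ∀ {n} b (X : Subset n) (g : Subset (suc n) → Carrier) →
    Σ (allSubsets n) (λ S → when ((b ∷ S) ≟ˢ (b ∷ X)) (g (b ∷ S))) ≈ g (b ∷ X)
  matching {n} b X g = trans
    (Σ-cong (allSubsets n) (λ S → when-⇔ ((b ∷ S) ≟ˢ (b ∷ X)) (S ≟ˢ X) (g (b ∷ S))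
                                    (λ eq → proj₂ (∷-injective eq)) (≡.cong (b ∷_))))
    (Σ-point X (λ S → g (b ∷ S)))

  missing : ∀ {n} b′ b (X : Subset n) (g : Subset (suc n) → Carrier) → b′ ≢ b →
    Σ (allSubsets n) (λ S → when ((b′ ∷ S) ≟ˢ (b ∷ X)) (g (b′ ∷ S))) ≈ 0#
  missing {n} b′ b X g b′≢b = Σ-zero (allSubsets n)
    (λ S → when-no ((b′ ∷ S) ≟ˢ (b ∷ X)) _ (λ eq → b′≢b (proj₁ (∷-injective eq))))

  Σ-point []          g = +-identityʳ (g [])
  Σ-point (true ∷ X)  g = trans (Σ-allSubsets-suc (λ S → when (S ≟ˢ (true ∷ X)) (g S)))
    (trans (+-cong (matching true X g) (missing false true X g (λ ()))) (+-identityʳ _))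
  Σ-point (false ∷ X) g = trans (Σ-allSubsets-suc (λ S → when (S ≟ˢ (false ∷ X)) (g S)))
    (trans (+-cong (missing true false X g (λ ())) (matching false X g)) (+-identityˡ _))

-- Reindexing the sum of marginal contributions, and the facet equations

module Reindexing {c ℓ ℓ≤} (K : OrderedField c ℓ ℓ≤) {n : ℕ} (Δ : SimplicialComplex n)
                  (p : Fin n → Subset n → OrderedField.Carrier K) where
  open OrderedField K
  open Sums K
  open ListSums commutativeRing
  open SubsetSums K
  open SimplicialComplex Δ
  open import Algebra.Properties.Ring ring using (x[y-z]≈xy-xz; [y-z]x≈yx-zx)
  open import Relation.Binary.Reasoning.Setoid setoid

  private
    AS = allSubsets n
    V  = allFin n

  -- gain S = Σ_{i ∈ S} p^i_{S∖i}: the weight with which v(S) enters positively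
  gain : Subset n → Carrier
  gain S = sumIn S (λ i → p i (S ─ ⁅ i ⁆))

  -- loss S = Σ_{j : S ∈ Lk(j)} p^j_S: the weight with which v(S) enters negatively
  loss : Subset n → Carrier
  loss S = sumLinkers Δ S (λ j → p j S)

  coeff : Subset n → Carrier
  coeff S = gain S - loss S

  link-to-face : ∀ i T S → InLink Δ i T × S ≡ T ∪ ⁅ i ⁆ → face S × (i ∈ S × T ≡ S ─ ⁅ i ⁆)
  link-to-face i T S ((_ , i∉T , face-T∪i) , ≡.refl) =
    face-T∪i , i∈S∪i T i , ≡.sym (∪-─-cancel T i i∉T)

  face-to-link : ∀ i T S → face S × (i ∈ S × T ≡ S ─ ⁅ i ⁆) → InLink Δ i T × S ≡ T ∪ ⁅ i ⁆
  face-to-link i T S (face-S , i∈S , ≡.refl) =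
    (down-closed face-S (p─q⊆p S ⁅ i ⁆) , i∉S─i S i , ≡.subst face (≡.sym S≡) face-S) , ≡.sym S≡
    where S≡ = ─-∪-cancel S i i∈S

  relabel : ∀ i T S y →
    when (InLink? Δ i T) (when (S ≟ˢ (T ∪ ⁅ i ⁆)) y)
      ≈ when (face? S) (when (i ∈? S) (when (T ≟ˢ (S ─ ⁅ i ⁆)) y))
  relabel i T S y = begin
    when IL (when eqS y)                  ≈⟨ when-× IL eqS y ⟩
    when (IL ×-dec eqS) y                 ≈⟨ when-⇔ (IL ×-dec eqS) (face? S ×-dec (i ∈? S ×-dec eqT)) y
                                               (link-to-face i T S) (face-to-link i T S) ⟩
    when (face? S ×-dec (i ∈? S ×-dec eqT)) y ≈⟨ when-× (face? S) (i ∈? S ×-dec eqT) y ⟨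
    when (face? S) (when (i ∈? S ×-dec eqT) y) ≈⟨ when-cong (face? S) (when-× (i ∈? S) eqT y) ⟨
    when (face? S) (when (i ∈? S) (when eqT y)) ∎
    where
    IL  = InLink? Δ i T
    eqS = S ≟ˢ (T ∪ ⁅ i ⁆)
    eqT = T ≟ˢ (S ─ ⁅ i ⁆)

  gain-sum : ∀ (v : Subset n → Carrier) →
    Σ V (λ i → Σ AS (λ T → when (InLink? Δ i T) (p i T * v (T ∪ ⁅ i ⁆))))
      ≈ Σ AS (λ S → when (face? S) (gain S * v S))
  gain-sum v = begin
    Σ V (λ i → Σ AS (λ T → when (IL i T) (p i T * v (T ∪ ⁅ i ⁆))))
      ≈⟨ Σ-cong V (λ i → Σ-cong AS (spread i)) ⟩
    Σ V (λ i → Σ AS (λ T → Σ AS (λ S → term i T S)))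
      ≈⟨ Σ-cong V (λ i → Σ-swap AS AS (term i)) ⟩
    Σ V (λ i → Σ AS (λ S → Σ AS (λ T → term i T S)))
      ≈⟨ Σ-cong V (λ i → Σ-cong AS (collapse i)) ⟩
    Σ V (λ i → Σ AS (λ S → when (face? S) (when (i ∈? S) (p i (S ─ ⁅ i ⁆) * v S))))
      ≈⟨ Σ-swap V AS _ ⟩
    Σ AS (λ S → Σ V (λ i → when (face? S) (when (i ∈? S) (p i (S ─ ⁅ i ⁆) * v S))))
      ≈⟨ Σ-cong AS collect ⟩
    Σ AS (λ S → when (face? S) (gain S * v S)) ∎
    where
    IL = InLink? Δ

    term : Fin n → Subset n → Subset n → Carrier
    term i T S = when (IL i T) (when (S ≟ˢ (T ∪ ⁅ i ⁆)) (p i T * v S))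

    -- v(T ∪ i) written as a sum over S of a point indicator
    spread : ∀ i T → when (IL i T) (p i T * v (T ∪ ⁅ i ⁆)) ≈ Σ AS (term i T)
    spread i T = trans (when-cong (IL i T) (sym (Σ-point (T ∪ ⁅ i ⁆) (λ S → p i T * v S))))
                       (when-Σ (IL i T) AS _)

    -- for fixed i and S, only T = S ∖ i contributes, and only if i ∈ S ∈ Δ
    collapse : ∀ i S → Σ AS (λ T → term i T S) ≈ when (face? S) (when (i ∈? S) (p i (S ─ ⁅ i ⁆) * v S))
    collapse i S = begin
      Σ AS (λ T → term i T S)
        ≈⟨ Σ-cong AS (λ T → relabel i T S (p i T * v S)) ⟩
      Σ AS (λ T → when (face? S) (when (i ∈? S) (when (T ≟ˢ (S ─ ⁅ i ⁆)) (p i T * v S))))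
        ≈⟨ when-Σ (face? S) AS _ ⟨
      when (face? S) (Σ AS (λ T → when (i ∈? S) (when (T ≟ˢ (S ─ ⁅ i ⁆)) (p i T * v S))))
        ≈⟨ when-cong (face? S) (when-Σ (i ∈? S) AS _) ⟨
      when (face? S) (when (i ∈? S) (Σ AS (λ T → when (T ≟ˢ (S ─ ⁅ i ⁆)) (p i T * v S))))
        ≈⟨ when-cong (face? S) (when-cong (i ∈? S) (Σ-point (S ─ ⁅ i ⁆) (λ T → p i T * v S))) ⟩
      when (face? S) (when (i ∈? S) (p i (S ─ ⁅ i ⁆) * v S)) ∎

    collect : ∀ S → Σ V (λ i → when (face? S) (when (i ∈? S) (p i (S ─ ⁅ i ⁆) * v S)))
                    ≈ when (face? S) (gain S * v S)
    collect S = begin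
      Σ V (λ i → when (face? S) (when (i ∈? S) (p i (S ─ ⁅ i ⁆) * v S)))
        ≈⟨ when-Σ (face? S) V _ ⟨
      when (face? S) (Σ V (λ i → when (i ∈? S) (p i (S ─ ⁅ i ⁆) * v S)))
        ≈⟨ when-cong (face? S) (Σ-cong V (λ i → when-*ʳ (i ∈? S) (p i (S ─ ⁅ i ⁆)) (v S))) ⟨
      when (face? S) (Σ V (λ i → when (i ∈? S) (p i (S ─ ⁅ i ⁆)) * v S))
        ≈⟨ when-cong (face? S) (Σ-*ʳ V (λ i → when (i ∈? S) (p i (S ─ ⁅ i ⁆))) (v S)) ⟩
      when (face? S) (Σ V (λ i → when (i ∈? S) (p i (S ─ ⁅ i ⁆))) * v S)
        ≈⟨ when-cong (face? S) (*-congʳ (sumWhere≈Σ (_∈? S) V (λ i → p i (S ─ ⁅ i ⁆)))) ⟨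
      when (face? S) (gain S * v S) ∎

  loss-sum : ∀ (v : Subset n → Carrier) →
    Σ V (λ i → Σ AS (λ T → when (InLink? Δ i T) (p i T * v T)))
      ≈ Σ AS (λ T → when (face? T) (loss T * v T))
  loss-sum v = trans (Σ-swap V AS _) (Σ-cong AS (λ T → collect T (face? T)))
    where
    collect : ∀ T (d : Dec (face T)) → Σ V (λ i → when (InLink? Δ i T) (p i T * v T)) ≈ when d (loss T * v T)
    collect T (no ¬face) = Σ-zero V (λ i → when-no (InLink? Δ i T) _ (λ T∈Lk → ¬face (proj₁ T∈Lk)))
    collect T (yes _)    = begin
      Σ V (λ i → when (InLink? Δ i T) (p i T * v T))
        ≈⟨ Σ-cong V (λ i → when-*ʳ (InLink? Δ i T) (p i T) (v T)) ⟨
      Σ V (λ i → when (InLink? Δ i T) (p i T) * v T)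
        ≈⟨ Σ-*ʳ V (λ i → when (InLink? Δ i T) (p i T)) (v T) ⟩
      Σ V (λ i → when (InLink? Δ i T) (p i T)) * v T
        ≈⟨ *-congʳ (sumWhere≈Σ (λ j → InLink? Δ j T) V (λ j → p j T)) ⟨
      loss T * v T ∎

  reindex : ∀ (v : Subset n → Carrier) →
    sumFin (λ i → sumLk Δ i (λ T → p i T * (v (T ∪ ⁅ i ⁆) - v T))) ≈ sumΔ Δ (λ S → coeff S * v S)
  reindex v = begin
    Σ V (λ i → sumLk Δ i (λ T → p i T * (v (T ∪ ⁅ i ⁆) - v T)))
      ≈⟨ Σ-cong V (λ i → trans (sumWhere≈Σ (InLink? Δ i) AS _) (Σ-cong AS (split i))) ⟩
    Σ V (λ i → Σ AS (λ T → when (IL i T) (p i T * v (T ∪ ⁅ i ⁆)) - when (IL i T) (p i T * v T)))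
      ≈⟨ Σ-cong V (λ i → Σ-− AS _ _) ⟩
    Σ V (λ i → Σ AS (λ T → when (IL i T) (p i T * v (T ∪ ⁅ i ⁆)))
               - Σ AS (λ T → when (IL i T) (p i T * v T)))
      ≈⟨ Σ-− V _ _ ⟩
    Σ V (λ i → Σ AS (λ T → when (IL i T) (p i T * v (T ∪ ⁅ i ⁆))))
      - Σ V (λ i → Σ AS (λ T → when (IL i T) (p i T * v T)))
      ≈⟨ +-cong (gain-sum v) (-‿cong (loss-sum v)) ⟩
    Σ AS (λ S → when (face? S) (gain S * v S)) - Σ AS (λ S → when (face? S) (loss S * v S))
      ≈⟨ Σ-− AS _ _ ⟨
    Σ AS (λ S → when (face? S) (gain S * v S) - when (face? S) (loss S * v S))
      ≈⟨ Σ-cong AS combine ⟩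
    Σ AS (λ S → when (face? S) (coeff S * v S))
      ≈⟨ sumWhere≈Σ face? AS _ ⟨
    sumΔ Δ (λ S → coeff S * v S) ∎
    where
    IL = InLink? Δ

    split : ∀ i T → when (IL i T) (p i T * (v (T ∪ ⁅ i ⁆) - v T))
                    ≈ when (IL i T) (p i T * v (T ∪ ⁅ i ⁆)) - when (IL i T) (p i T * v T)
    split i T = trans (when-cong (IL i T) (x[y-z]≈xy-xz _ _ _)) (when-− (IL i T) _ _)

    combine : ∀ S → when (face? S) (gain S * v S) - when (face? S) (loss S * v S)
                    ≈ when (face? S) (coeff S * v S)
    combine S = trans (sym (when-− (face? S) _ _)) (when-cong (face? S) (sym ([y-z]x≈yx-zx _ _ _)))

  -- On a facet the loss vanishes, since a facet lies in no link.
  coeff-facet : ∀ F → IsFacet Δ F → coeff F ≈ gain F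
  coeff-facet F facet = trans (+-congˡ (-‿cong loss≈0)) (x-0≈x (gain F))
    where
    loss≈0 : loss F ≈ 0#
    loss≈0 = sumWhere-none (λ j → InLink? Δ j F) V (λ j → p j F)
                           (λ j → Facets.facet-unlinked Δ F j facet)

  coeff-agreement⇔conditions : (a : Subset n → Carrier) →
    (∀ T → face T → Nonempty T → coeff T ≈ a T)
    ⇔ ((∀ T → face T → Nonempty T → ¬ IsFacet Δ T → coeff T ≈ a T)
       × (∀ F → IsFacet Δ F → Nonempty F → gain F ≈ a F))
  coeff-agreement⇔conditions a = mk⇔ to from
    where
    to : (∀ T → face T → Nonempty T → coeff T ≈ a T) → _
    to agree = (λ T face-T T≢∅ _ → agree T face-T T≢∅)
             , (λ F facet F≢∅ → trans (sym (coeff-facet F facet)) (agree F (proj₁ facet) F≢∅))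

    from : _ → ∀ T → face T → Nonempty T → coeff T ≈ a T
    from (off-facets , on-facets) T face-T T≢∅ with Facets.facet-or-linked Δ T face-T
    ... | inj₁ facet        = trans (coeff-facet T facet) (on-facets T facet T≢∅)
    ... | inj₂ (j , T∈Lkj) = off-facets T face-T T≢∅ (λ facet → Facets.facet-unlinked Δ T j facet T∈Lkj)

-- Probing linear functionals with carrier games

module Probing {c ℓ ℓ≤} (K : OrderedField c ℓ ℓ≤) {n : ℕ} (Δ : SimplicialComplex n) where
  open OrderedField K
  open Sums K
  open ListSums commutativeRing
  open SubsetSums K
  open Games K Δ
  open SimplicialComplex Δ
  open import Relation.Binary.Reasoning.Setoid setoid

  carrier-difference : ∀ T (f : Subset n → Carrier) S → face S →
    f S * carrier T S - f S * carrierHat T S ≈ when (S ≟ˢ T) (f S)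
  carrier-difference T f S face-S with face? S | T ⊆? S | T ⊂? S
  ... | no ¬face | _       | _     = ⊥-elim (¬face face-S)
  ... | yes _    | yes T⊆S | yes T⊂S =
    trans (-‿inverseʳ _) (sym (when-no (S ≟ˢ T) (f S) (λ { ≡.refl → ⊂-irref ≡.refl T⊂S })))
  ... | yes _    | yes T⊆S | no T⊄S  = begin
    f S * 1# - f S * 0# ≈⟨ +-cong (*-identityʳ (f S)) (-‿cong (zeroʳ (f S))) ⟩
    f S - 0#            ≈⟨ x-0≈x (f S) ⟩
    f S                 ≈⟨ when-yes (S ≟ˢ T) (f S) (≡.sym (⊆∧⊄⇒≡ T⊆S T⊄S)) ⟨
    when (S ≟ˢ T) (f S) ∎
  ... | yes _    | no T⊈S  | yes T⊂S = ⊥-elim (T⊈S (proj₁ T⊂S))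
  ... | yes _    | no T⊈S  | no _    =
    trans (-‿inverseʳ _) (sym (when-no (S ≟ˢ T) (f S) (λ { ≡.refl → T⊈S (λ x∈T → x∈T) })))

  probe : ∀ T → face T → (f : Subset n → Carrier) →
    sumΔ Δ (λ S → f S * carrier T S) - sumΔ Δ (λ S → f S * carrierHat T S) ≈ f T
  probe T face-T f = begin
    sumΔ Δ (λ S → f S * carrier T S) - sumΔ Δ (λ S → f S * carrierHat T S)
      ≈⟨ +-cong (sumWhere≈Σ face? AS _) (-‿cong (sumWhere≈Σ face? AS _)) ⟩
    Σ AS (λ S → when (face? S) (f S * carrier T S)) - Σ AS (λ S → when (face? S) (f S * carrierHat T S))
      ≈⟨ Σ-− AS _ _ ⟨
    Σ AS (λ S → when (face? S) (f S * carrier T S) - when (face? S) (f S * carrierHat T S))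
      ≈⟨ Σ-cong AS (λ S → indicator S (face? S)) ⟩
    Σ AS (λ S → when (S ≟ˢ T) (f S))
      ≈⟨ Σ-point T f ⟩
    f T ∎
    where
    AS = allSubsets n

    indicator : ∀ S (d : Dec (face S)) →
      when d (f S * carrier T S) - when d (f S * carrierHat T S) ≈ when (S ≟ˢ T) (f S)
    indicator S (yes face-S) = carrier-difference T f S face-S
    indicator S (no ¬face)   =
      trans (x-0≈x 0#) (sym (when-no (S ≟ˢ T) (f S) (λ { ≡.refl → ¬face face-T })))

  -- On a set of games containing the carrier games of all nonempty faces,
  -- two coefficient vectors induce the same linear functional iff they agree
  -- on all nonempty faces (the empty face does not matter since v(∅) = 0).
  functional-agreement⇔coeff-agreement : ∀ {ι} (𝔍 : Pred Game ι) → (∀ v → 𝔍 v → IsGame v) →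
    (∀ T → face T → Nonempty T → 𝔍 (carrier T) × 𝔍 (carrierHat T)) →
    (f g : Subset n → Carrier) →
    (∀ v → 𝔍 v → sumΔ Δ (λ S → f S * v S) ≈ sumΔ Δ (λ S → g S * v S))
    ⇔ (∀ T → face T → Nonempty T → f T ≈ g T)
  functional-agreement⇔coeff-agreement 𝔍 games carriers f g = mk⇔ to from
    where
    to : (∀ v → 𝔍 v → sumΔ Δ (λ S → f S * v S) ≈ sumΔ Δ (λ S → g S * v S)) →
         ∀ T → face T → Nonempty T → f T ≈ g T
    to same T face-T T≢∅ = begin
      f T
        ≈⟨ probe T face-T f ⟨
      sumΔ Δ (λ S → f S * carrier T S) - sumΔ Δ (λ S → f S * carrierHat T S)
        ≈⟨ +-cong (same _ (proj₁ (carriers T face-T T≢∅)))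
                  (-‿cong (same _ (proj₂ (carriers T face-T T≢∅)))) ⟩
      sumΔ Δ (λ S → g S * carrier T S) - sumΔ Δ (λ S → g S * carrierHat T S)
        ≈⟨ probe T face-T g ⟩
      g T ∎

    from : (∀ T → face T → Nonempty T → f T ≈ g T) →
           ∀ v → 𝔍 v → sumΔ Δ (λ S → f S * v S) ≈ sumΔ Δ (λ S → g S * v S)
    from agree v v∈𝔍 = sumWhere-cong face? (allSubsets n) pointwise
      where
      pointwise : ∀ S → face S → f S * v S ≈ g S * v S
      pointwise S face-S with nonempty? S
      ... | yes S≢∅ = *-congʳ (agree S face-S S≢∅)
      ... | no  S≡∅ = trans (*-congˡ v≈0) (trans (zeroʳ _) (sym (trans (*-congˡ v≈0) (zeroʳ _))))
        where
        v≈0 : v S ≈ 0#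
        v≈0 = ≡.subst (λ X → v X ≈ 0#) (≡.sym (Empty-unique S≡∅)) (proj₁ (games v v∈𝔍))

theorem2p1 : ∀ {c ℓ ℓ≤ ι} (K : OrderedField c ℓ ℓ≤) {n : ℕ} (Δ : SimplicialComplex n) →
    let open OrderedField K
        open Sums K
        open Games K Δ
        open SimplicialComplex Δ
    in (a : Subset n → Carrier) (𝔍 : Pred Game ι) → IsCone 𝔍 →
       (∀ T → face T → Nonempty T → 𝔍 (carrier T) × 𝔍 (carrierHat T)) →
       (φ : Fin n → (v : Game) → 𝔍 v → Carrier) →
       (p : Fin n → Subset n → Carrier) →
       (∀ i v (h : 𝔍 v) → φ i v h ≈ sumLk Δ i (λ T → p i T * (v (T ∪ ⁅ i ⁆) - v T))) →
       ((∀ v (h : 𝔍 v) → sumFin (λ i → φ i v h) ≈ sumΔ Δ (λ T → a T * v T))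
        ⇔ ((∀ T → face T → Nonempty T → ¬ IsFacet Δ T →
              sumIn T (λ i → p i (T ─ ⁅ i ⁆)) - sumLinkers Δ T (λ j → p j T) ≈ a T)
           × (∀ F → IsFacet Δ F → Nonempty F → sumIn F (λ i → p i (F ─ ⁅ i ⁆)) ≈ a F)))
theorem2p1 K {n} Δ a 𝔍 cone carriers φ p φ-formula =
  coeff-agreement⇔conditions a
    ⇔-∘ (functional-agreement⇔coeff-agreement 𝔍 (proj₁ cone) carriers coeff a
    ⇔-∘ efficiency⇔functional-agreement)
  where
  open OrderedField K
  open Sums K
  open ListSums commutativeRing using (Σ-cong)
  open Reindexing K Δ p using (coeff; reindex; coeff-agreement⇔conditions)
  open Probing K Δ using (functional-agreement⇔coeff-agreement)

  total : ∀ v (h : 𝔍 v) → sumFin (λ i → φ i v h) ≈ sumΔ Δ (λ S → coeff S * v S)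
  total v h = trans (Σ-cong (allFin n) (λ i → φ-formula i v h)) (reindex v)

  efficiency⇔functional-agreement :
    (∀ v (h : 𝔍 v) → sumFin (λ i → φ i v h) ≈ sumΔ Δ (λ T → a T * v T))
    ⇔ (∀ v → 𝔍 v → sumΔ Δ (λ S → coeff S * v S) ≈ sumΔ Δ (λ S → a S * v S))
  efficiency⇔functional-agreement =
    mk⇔ (λ efficient v h → trans (sym (total v h)) (efficient v h))
        (λ agree v h → trans (total v h) (agree v h))
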